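{- Let $G$ be a $(k_G,t_G)$-star colorable graph with $t_G\geq\chi(G)$. Then for every positive integer $d$, the graph $G_d=G\square G\square\cdots\square G$ ($d$ factors) is $(d\,k_G,t_G)$-star colorable.
   Context: All graphs are finite, simple and undirected. A star edge coloring of a graph is a proper edge coloring such that no path or cycle with four edges uses at most two colors. $\chi$ denotes the chromatic number. For an edge coloring $f$ and a vertex $v$, $A_f(v)$ denotes the set of colors of edges incident to $v$. Two star edge colorings $f_1,f_2$ of $G$ are star compatible if $A_{f_1}(v)\cap A_{f_2}(v)=\emptyset$ for every vertex $v$. $G$ is $(k,t)$-star colorable if $G$ has $t$ pairwise star compatible star edge colorings $f_i:E(G)\to\{0,1,\ldots,k-1\}$, $1\le i\le t$. The Cartesian product $G\square H$ has vertex set $V(G)\times V(H)$, with $(a,x)(b,y)$ an edge iff either $ab\in E(G)$ and $x=y$, or $xy\in E(H)$ and $a=b$. -}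

module Defs where

open import Data.Nat using (ℕ; zero; suc; _*_; _≤_; NonZero)
open import Data.Fin using (Fin; remQuot)
open import Data.Product using (Σ; ∃; ∃-syntax; _×_; _,_; proj₁; proj₂)
open import Data.Sum using (_⊎_; inj₁; inj₂)
open import Relation.Binary.PropositionalEquality using (_≡_; _≢_) renaming (sym to ≡-sym)
open import Relation.Nullary using (¬_)

record Graph : Set₁ where
  field
    n      : ℕ
    Adj    : Fin n → Fin n → Set
    sym    : ∀ {u v} → Adj u v → Adj v u
    irrefl : ∀ {v} → ¬ Adj v v
open Graph public

V : Graph → Set
V G = Fin (n G)

ProperVertexColoring : (G : Graph) (c : ℕ) → (V G → Fin c) → Set
ProperVertexColoring G c f = ∀ {u v} → Adj G u v → f u ≢ f v

Colorable : Graph → ℕ → Set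
Colorable G c = Σ (V G → Fin c) (ProperVertexColoring G c)

IsChromaticNumber : Graph → ℕ → Set
IsChromaticNumber G χ = Colorable G χ × (∀ c → Colorable G c → χ ≤ c)

-- An edge coloring with colors {0,…,k-1}: a function on ordered vertex pairs,
-- only its values on edges matter, and it must agree on both orientations.
record EdgeColoring (G : Graph) (k : ℕ) : Set where
  field
    col  : V G → V G → Fin k
    symm : ∀ {u v} → Adj G u v → col u v ≡ col v u
open EdgeColoring public

Proper : {G : Graph} {k : ℕ} → EdgeColoring G k → Set
Proper {G} f = ∀ {u v w} → Adj G u v → Adj G v w → u ≢ w → col f u v ≢ col f v w

-- v0 v1 v2 v3 v4 is a path with four edges, or a cycle with four edges (v4 = v0)
Path4 : (G : Graph) → (v0 v1 v2 v3 v4 : V G) → Set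
Path4 G v0 v1 v2 v3 v4 =
  v0 ≢ v1 × v0 ≢ v2 × v0 ≢ v3 × v0 ≢ v4 × v1 ≢ v2 × v1 ≢ v3 × v1 ≢ v4
  × v2 ≢ v3 × v2 ≢ v4 × v3 ≢ v4

Cycle4 : (G : Graph) → (v0 v1 v2 v3 v4 : V G) → Set
Cycle4 G v0 v1 v2 v3 v4 =
  v0 ≢ v1 × v0 ≢ v2 × v0 ≢ v3 × v1 ≢ v2 × v1 ≢ v3 × v2 ≢ v3 × v4 ≡ v0

Walk4Edges : (G : Graph) → (v0 v1 v2 v3 v4 : V G) → Set
Walk4Edges G v0 v1 v2 v3 v4 =
  Adj G v0 v1 × Adj G v1 v2 × Adj G v2 v3 × Adj G v3 v4

AtMostTwo : {k : ℕ} → Fin k → Fin k → Fin k → Fin k → Set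
AtMostTwo {k} c1 c2 c3 c4 =
  ∃[ a ] ∃[ b ] ((c1 ≡ a ⊎ c1 ≡ b) × (c2 ≡ a ⊎ c2 ≡ b)
               × (c3 ≡ a ⊎ c3 ≡ b) × (c4 ≡ a ⊎ c4 ≡ b))

StarEdgeColoring : {G : Graph} {k : ℕ} → EdgeColoring G k → Set
StarEdgeColoring {G} f =
  Proper f ×
  (∀ v0 v1 v2 v3 v4 → Walk4Edges G v0 v1 v2 v3 v4 →
     (Path4 G v0 v1 v2 v3 v4 ⊎ Cycle4 G v0 v1 v2 v3 v4) →
     ¬ AtMostTwo (col f v0 v1) (col f v1 v2) (col f v2 v3) (col f v3 v4))

StarCompatible : {G : Graph} {k : ℕ} → EdgeColoring G k → EdgeColoring G k → Set
StarCompatible {G} f1 f2 =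
  ∀ {v u w} → Adj G v u → Adj G v w → col f1 v u ≢ col f2 v w

StarColorable : Graph → ℕ → ℕ → Set
StarColorable G k t =
  Σ (Fin t → EdgeColoring G k) λ f →
    (∀ i → StarEdgeColoring (f i)) ×
    (∀ i j → i ≢ j → StarCompatible (f i) (f j))

-- Cartesian product; vertex set Fin (n G * n H) ≅ Fin (n G) × Fin (n H) via remQuot
-- first and second coordinates of a vertex of G □ H
fstV : (G H : Graph) → Fin (n G * n H) → Fin (n G)
fstV G H p = proj₁ (remQuot {n G} (n H) p)

sndV : (G H : Graph) → Fin (n G * n H) → Fin (n H)
sndV G H p = proj₂ (remQuot {n G} (n H) p)

ProdAdj : (G H : Graph) → Fin (n G * n H) → Fin (n G * n H) → Set
ProdAdj G H p q =
  (Adj G (fstV G H p) (fstV G H q) × sndV G H p ≡ sndV G H q)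
  ⊎ (fstV G H p ≡ fstV G H q × Adj H (sndV G H p) (sndV G H q))

□-sym : (G H : Graph) → ∀ {p q} → ProdAdj G H p q → ProdAdj G H q p
□-sym G H (inj₁ (g , e)) = inj₁ (sym G g , ≡-sym e)
□-sym G H (inj₂ (e , h)) = inj₂ (≡-sym e , sym H h)

□-irrefl : (G H : Graph) → ∀ {p} → ¬ ProdAdj G H p p
□-irrefl G H (inj₁ (g , _)) = irrefl G g
□-irrefl G H (inj₂ (_ , h)) = irrefl H h

_□_ : Graph → Graph → Graph
G □ H = record
  { n = n G * n H ; Adj = ProdAdj G H ; sym = □-sym G H ; irrefl = □-irrefl G H }

power : Graph → (d : ℕ) → .{{NonZero d}} → Graph
power G (suc zero) = G
power G (suc (suc d)) = G □ power G (suc d)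

module Submission where

-- The corollary follows from a product theorem, proved by induction on d:
--
--   if G is (k_G,t)-star colourable and properly t-vertex-colourable by c, and
--   H is (k_H,t)-star colourable, then G □ H is (k_G + k_H, t)-star colourable.
--
-- Let f_1..f_t and g_1..g_t be the compatible star edge colourings of G and H,
-- and L(i,j) = i + j (mod t) a Latin square on {0..t-1}.  The i-th colouring
-- of G □ H gives a G-edge (u,x)(v,x) the colour f_i(uv) from the first block of
-- k_G colours, and an H-edge (u,x)(u,y) the colour g_{L(i,c(u))}(xy) from the
-- second block of k_H colours.  A bichromatic 4-path or 4-cycle alternates
-- between two colours; since the blocks are disjoint, either all its edges lie
-- in one fibre (contradicting that f_i resp. g_j is a star colouring), or it
-- contains H-edges in the fibres over adjacent u, w meeting at a vertex of H,
-- which is impossible because g_{L(i,c(u))} and g_{L(i,c(w))} are compatible.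

open import Defs
open import Data.Nat using (ℕ; zero; suc; _+_; _*_; _∸_; _<_; _≤_; NonZero)
open import Data.Nat.Properties using (+-assoc; +-comm; +-identityʳ; m+[n∸m]≡n; <⇒≤)
open import Data.Nat.DivMod using (_%_; m%n<n; [m+n]%n≡m%n; m<n⇒m%n≡m; %-distribˡ-+)
open import Data.Fin as Fin using (Fin; toℕ; fromℕ<; _↑ˡ_; _↑ʳ_; inject≤; splitAt; combine)
open import Data.Fin.Properties
  using (toℕ-injective; toℕ-fromℕ<; toℕ<n; ↑ˡ-injective; ↑ʳ-injective; splitAt-↑ˡ; splitAt-↑ʳ;
         inject≤-injective; combine-remQuot)
open import Data.Product using (∃-syntax; _×_; _,_; proj₁; proj₂)
open import Data.Sum using (_⊎_; inj₁; inj₂)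
open import Data.Empty using (⊥-elim)
open import Function using (_∘_; flip)
open import Relation.Nullary using (¬_; yes; no)
open import Relation.Binary.PropositionalEquality
  using (_≡_; _≢_; refl; trans; cong; cong₂; subst; module ≡-Reasoning)
  renaming (sym to ≡-sym)

colorable-≤ : ∀ {G c c'} → c ≤ c' → Colorable G c → Colorable G c'
colorable-≤ c≤c' (κ , κ-proper) =
  (λ v → inject≤ (κ v) c≤c') , λ a e → κ-proper a (inject≤-injective c≤c' c≤c' _ _ e)

+-∸-%-inverse : ∀ a c t .{{_ : NonZero t}} → a < t → c ≤ t → (a + c + (t ∸ c)) % t ≡ a
+-∸-%-inverse a c t a<t c≤t = begin
  (a + c + (t ∸ c)) % t ≡⟨ cong (_% t) (+-assoc a c (t ∸ c)) ⟩
  (a + (c + (t ∸ c))) % t ≡⟨ cong (λ x → (a + x) % t) (m+[n∸m]≡n c≤t) ⟩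
  (a + t) % t ≡⟨ [m+n]%n≡m%n a t ⟩
  a % t ≡⟨ m<n⇒m%n≡m a<t ⟩
  a ∎
  where open ≡-Reasoning

+-%-cancelʳ : ∀ {a b} c t .{{_ : NonZero t}} → a < t → b < t → c ≤ t →
  (a + c) % t ≡ (b + c) % t → a ≡ b
+-%-cancelʳ {a} {b} c t a<t b<t c≤t e = begin
  a ≡⟨ ≡-sym (+-∸-%-inverse a c t a<t c≤t) ⟩
  (a + c + (t ∸ c)) % t ≡⟨ %-distribˡ-+ (a + c) (t ∸ c) t ⟩
  ((a + c) % t + (t ∸ c) % t) % t ≡⟨ cong (λ x → (x + (t ∸ c) % t) % t) e ⟩
  ((b + c) % t + (t ∸ c) % t) % t ≡⟨ ≡-sym (%-distribˡ-+ (b + c) (t ∸ c) t) ⟩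
  (b + c + (t ∸ c)) % t ≡⟨ +-∸-%-inverse b c t b<t c≤t ⟩
  b ∎
  where open ≡-Reasoning

latin : ∀ {t} → Fin t → Fin t → Fin t
latin {suc t} i j = fromℕ< (m%n<n (toℕ i + toℕ j) (suc t))

toℕ-latin : ∀ {t} (i j : Fin (suc t)) → toℕ (latin i j) ≡ (toℕ i + toℕ j) % suc t
toℕ-latin i j = toℕ-fromℕ< _

latin-comm : ∀ {t} (i j : Fin t) → latin i j ≡ latin j i
latin-comm {suc t} i j = toℕ-injective (begin
  toℕ (latin i j) ≡⟨ toℕ-latin i j ⟩
  (toℕ i + toℕ j) % suc t ≡⟨ cong (_% suc t) (+-comm (toℕ i) (toℕ j)) ⟩
  (toℕ j + toℕ i) % suc t ≡⟨ ≡-sym (toℕ-latin j i) ⟩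
  toℕ (latin j i) ∎)
  where open ≡-Reasoning

latin-injˡ : ∀ {t} {i j c : Fin t} → latin i c ≡ latin j c → i ≡ j
latin-injˡ {suc t} {i} {j} {c} e = toℕ-injective
  (+-%-cancelʳ (toℕ c) (suc t) (toℕ<n i) (toℕ<n j) (<⇒≤ (toℕ<n c))
    (trans (≡-sym (toℕ-latin i c)) (trans (cong toℕ e) (toℕ-latin j c))))

latin-injʳ : ∀ {t} {i c c' : Fin t} → latin i c ≡ latin i c' → c ≡ c'
latin-injʳ {i = i} {c} {c'} e = latin-injˡ (trans (latin-comm c i) (trans e (latin-comm i c')))

PathOrCycle4 : (X : Graph) → (v0 v1 v2 v3 v4 : V X) → Set
PathOrCycle4 X v0 v1 v2 v3 v4 = Path4 X v0 v1 v2 v3 v4 ⊎ Cycle4 X v0 v1 v2 v3 v4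

-- In a proper colouring a 4-path or 4-cycle
-- uses at most two colours exactly when its colours alternate, so the star
-- condition can be checked as "no alternating 4-path or 4-cycle".
Alternating : ∀ {k} → Fin k → Fin k → Fin k → Fin k → Set
Alternating c1 c2 c3 c4 = c1 ≡ c3 × c2 ≡ c4

alternating⇒atMostTwo : ∀ {k} {c1 c2 c3 c4 : Fin k} →
  Alternating c1 c2 c3 c4 → AtMostTwo c1 c2 c3 c4
alternating⇒atMostTwo {c1 = c1} {c2} (e13 , e24) =
  c1 , c2 , inj₁ refl , inj₂ refl , inj₁ (≡-sym e13) , inj₂ (≡-sym e24)

skip-equal : ∀ {k} {a b x y z : Fin k} → x ≢ y → y ≢ z →
  (x ≡ a ⊎ x ≡ b) → (y ≡ a ⊎ y ≡ b) → (z ≡ a ⊎ z ≡ b) → x ≡ z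
skip-equal _   _   (inj₁ p) _        (inj₁ r) = trans p (≡-sym r)
skip-equal _   _   (inj₂ p) _        (inj₂ r) = trans p (≡-sym r)
skip-equal x≢y _   (inj₁ p) (inj₁ q) (inj₂ _) = ⊥-elim (x≢y (trans p (≡-sym q)))
skip-equal _   y≢z (inj₁ _) (inj₂ q) (inj₂ r) = ⊥-elim (y≢z (trans q (≡-sym r)))
skip-equal x≢y _   (inj₂ p) (inj₂ q) (inj₁ _) = ⊥-elim (x≢y (trans p (≡-sym q)))
skip-equal _   y≢z (inj₂ _) (inj₁ q) (inj₁ r) = ⊥-elim (y≢z (trans q (≡-sym r)))

atMostTwo⇒alternating : ∀ {k} {c1 c2 c3 c4 : Fin k} → c1 ≢ c2 → c2 ≢ c3 → c3 ≢ c4 →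
  AtMostTwo c1 c2 c3 c4 → Alternating c1 c2 c3 c4
atMostTwo⇒alternating n12 n23 n34 (_ , _ , m1 , m2 , m3 , m4) =
  skip-equal n12 n23 m1 m2 m3 , skip-equal n23 n34 m2 m3 m4

pathOrCycle-skip : ∀ {X v0 v1 v2 v3 v4} → PathOrCycle4 X v0 v1 v2 v3 v4 →
  v0 ≢ v2 × v1 ≢ v3 × v2 ≢ v4
pathOrCycle-skip (inj₁ (_ , d02 , _ , _ , _ , d13 , _ , _ , d24 , _)) = d02 , d13 , d24
pathOrCycle-skip (inj₂ (_ , d02 , _ , _ , d13 , _ , v4≡v0)) =
  d02 , d13 , λ v2≡v4 → d02 (≡-sym (trans v2≡v4 v4≡v0))

proper⇒alternating : ∀ {X k} {f : EdgeColoring X k} → Proper f → ∀ {v0 v1 v2 v3 v4} →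
  Walk4Edges X v0 v1 v2 v3 v4 → PathOrCycle4 X v0 v1 v2 v3 v4 →
  AtMostTwo (col f v0 v1) (col f v1 v2) (col f v2 v3) (col f v3 v4) →
  Alternating (col f v0 v1) (col f v1 v2) (col f v2 v3) (col f v3 v4)
proper⇒alternating {X} proper (a1 , a2 , a3 , a4) poc with pathOrCycle-skip {X} poc
... | d02 , d13 , d24 =
  atMostTwo⇒alternating (proper a1 a2 d02) (proper a2 a3 d13) (proper a3 a4 d24)

star-intro : ∀ {X k} {f : EdgeColoring X k} → Proper f →
  (∀ v0 v1 v2 v3 v4 → Walk4Edges X v0 v1 v2 v3 v4 → PathOrCycle4 X v0 v1 v2 v3 v4 →
     ¬ Alternating (col f v0 v1) (col f v1 v2) (col f v2 v3) (col f v3 v4)) →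
  StarEdgeColoring f
star-intro {X} {f = f} proper no-alt =
  proper , λ v0 v1 v2 v3 v4 w poc → no-alt v0 v1 v2 v3 v4 w poc ∘ proper⇒alternating {X} {f = f} proper w poc

star-elim : ∀ {X k} {f : EdgeColoring X k} → StarEdgeColoring f → ∀ {v0 v1 v2 v3 v4} →
  Walk4Edges X v0 v1 v2 v3 v4 → PathOrCycle4 X v0 v1 v2 v3 v4 →
  ¬ Alternating (col f v0 v1) (col f v1 v2) (col f v2 v3) (col f v3 v4)
star-elim (_ , star) {v0} {v1} {v2} {v3} {v4} w poc = star v0 v1 v2 v3 v4 w poc ∘ alternating⇒atMostTwo

-- Applied to the two coordinates of a
-- product, this projects a walk inside a fibre to a factor.
module _ {X Y : Graph} {A : Set} (π : V X → V Y) (σ : V X → A)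
  (joint : ∀ {p q} → π p ≡ π q → σ p ≡ σ q → p ≡ q) where

  private
    separate : ∀ {p q z} → σ p ≡ z → σ q ≡ z → p ≢ q → π p ≢ π q
    separate sp sq p≢q e = p≢q (joint e (trans sp (≡-sym sq)))

  pathOrCycle-project : ∀ {z v0 v1 v2 v3 v4} →
    σ v0 ≡ z → σ v1 ≡ z → σ v2 ≡ z → σ v3 ≡ z → σ v4 ≡ z →
    PathOrCycle4 X v0 v1 v2 v3 v4 → PathOrCycle4 Y (π v0) (π v1) (π v2) (π v3) (π v4)
  pathOrCycle-project s0 s1 s2 s3 s4 (inj₁ (d01 , d02 , d03 , d04 , d12 , d13 , d14 , d23 , d24 , d34)) =
    inj₁ (separate s0 s1 d01 , separate s0 s2 d02 , separate s0 s3 d03 , separate s0 s4 d04 ,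
          separate s1 s2 d12 , separate s1 s3 d13 , separate s1 s4 d14 , separate s2 s3 d23 ,
          separate s2 s4 d24 , separate s3 s4 d34)
  pathOrCycle-project s0 s1 s2 s3 _ (inj₂ (d01 , d02 , d03 , d12 , d13 , d23 , v4≡v0)) =
    inj₂ (separate s0 s1 d01 , separate s0 s2 d02 , separate s0 s3 d03 , separate s1 s2 d12 ,
          separate s1 s3 d13 , separate s2 s3 d23 , cong π v4≡v0)

↑ˡ≢↑ʳ : ∀ {k l} (x : Fin k) (y : Fin l) → x ↑ˡ l ≢ k ↑ʳ y
↑ˡ≢↑ʳ {k} {l} x y e with trans (≡-sym (splitAt-↑ˡ k x l)) (trans (cong (splitAt k) e) (splitAt-↑ʳ k l y))
... | ()

π-injective : ∀ G H {p q : V (G □ H)} → fstV G H p ≡ fstV G H q → sndV G H p ≡ sndV G H q → p ≡ q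
π-injective G H {p} {q} e₁ e₂ =
  trans (≡-sym (combine-remQuot {n G} (n H) p))
    (trans (cong₂ combine e₁ e₂) (combine-remQuot {n G} (n H) q))

module ProductColouring {G H : Graph} {kG kH t : ℕ}
  (SG : StarColorable G kG t) (SH : StarColorable H kH t) (vc : Colorable G t) where

  P : Graph
  P = G □ H

  π₁ : V P → V G
  π₁ = fstV G H

  π₂ : V P → V H
  π₂ = sndV G H

  f : Fin t → EdgeColoring G kG
  f = proj₁ SG

  g : Fin t → EdgeColoring H kH
  g = proj₁ SH

  f-star : ∀ i → StarEdgeColoring (f i)
  f-star = proj₁ (proj₂ SG)

  f-compatible : ∀ i j → i ≢ j → StarCompatible (f i) (f j)
  f-compatible = proj₂ (proj₂ SG)

  g-star : ∀ i → StarEdgeColoring (g i)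
  g-star = proj₁ (proj₂ SH)

  g-compatible : ∀ i j → i ≢ j → StarCompatible (g i) (g j)
  g-compatible = proj₂ (proj₂ SH)

  c : V G → Fin t
  c = proj₁ vc

  c-proper : ProperVertexColoring G t c
  c-proper = proj₂ vc

  -- In the i-th colouring of P, the fibre over u ∈ V G is coloured by g (fibre i u).
  fibre : Fin t → V G → Fin t
  fibre i u = latin i (c u)

  colour : Fin t → V P → V P → Fin (kG + kH)
  colour i p q with π₁ p Fin.≟ π₁ q
  ... | yes _ = kG ↑ʳ col (g (fibre i (π₁ p))) (π₂ p) (π₂ q)
  ... | no _  = col (f i) (π₁ p) (π₁ q) ↑ˡ kH

  colour-G : ∀ i {p q} → Adj G (π₁ p) (π₁ q) → colour i p q ≡ col (f i) (π₁ p) (π₁ q) ↑ˡ kH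
  colour-G i {p} {q} a with π₁ p Fin.≟ π₁ q
  ... | yes e = ⊥-elim (irrefl G (subst (Adj G (π₁ p)) (≡-sym e) a))
  ... | no _  = refl

  colour-H : ∀ i {u p q} → π₁ p ≡ u → π₁ q ≡ u →
    colour i p q ≡ kG ↑ʳ col (g (fibre i u)) (π₂ p) (π₂ q)
  colour-H i {u} {p} {q} pu qu with π₁ p Fin.≟ π₁ q
  ... | yes _ = cong (λ w → kG ↑ʳ col (g (fibre i w)) (π₂ p) (π₂ q)) pu
  ... | no p≢q = ⊥-elim (p≢q (trans pu (≡-sym qu)))

  G-colours : ∀ i j {p q r s} → Adj G (π₁ p) (π₁ q) → Adj G (π₁ r) (π₁ s) → colour i p q ≡ colour j r s →
    col (f i) (π₁ p) (π₁ q) ≡ col (f j) (π₁ r) (π₁ s)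
  G-colours i j a b e = ↑ˡ-injective kH _ _ (trans (≡-sym (colour-G i a)) (trans e (colour-G j b)))

  H-colours : ∀ i j {u w p q r s} → π₁ p ≡ u → π₁ q ≡ u → π₁ r ≡ w → π₁ s ≡ w →
    colour i p q ≡ colour j r s → col (g (fibre i u)) (π₂ p) (π₂ q) ≡ col (g (fibre j w)) (π₂ r) (π₂ s)
  H-colours i j pu qu rw sw e =
    ↑ʳ-injective kG _ _ (trans (≡-sym (colour-H i pu qu)) (trans e (colour-H j rw sw)))

  G≢H-colour : ∀ i j {p q r s} → Adj G (π₁ p) (π₁ q) → π₁ r ≡ π₁ s → colour i p q ≢ colour j r s
  G≢H-colour i j a rs e = ↑ˡ≢↑ʳ _ _ (trans (≡-sym (colour-G i a)) (trans e (colour-H j refl (≡-sym rs))))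

  colour-symm : ∀ i {p q} → ProdAdj G H p q → colour i p q ≡ colour i q p
  colour-symm i (inj₁ (a , _)) =
    trans (colour-G i a) (trans (cong (_↑ˡ kH) (symm (f i) a)) (≡-sym (colour-G i (sym G a))))
  colour-symm i (inj₂ (pq , h)) =
    trans (colour-H i refl (≡-sym pq))
      (trans (cong (kG ↑ʳ_) (symm (g _) h)) (≡-sym (colour-H i (≡-sym pq) refl)))

  colouring : Fin t → EdgeColoring P (kG + kH)
  colouring i = record { col = colour i ; symm = colour-symm i }

  proper : ∀ i → Proper (colouring i)
  proper i (inj₁ (a , uv)) (inj₁ (b , vw)) u≢w e =
    proj₁ (f-star i) a b (λ x → u≢w (π-injective G H x (trans uv vw))) (G-colours i i a b e)
  proper i (inj₂ (uv , h)) (inj₂ (vw , h')) u≢w e =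
    proj₁ (g-star _) h h' (λ y → u≢w (π-injective G H (trans uv vw) y))
      (H-colours i i uv refl refl (≡-sym vw) e)
  proper i (inj₁ (a , _)) (inj₂ (vw , _)) _ e = G≢H-colour i i a vw e
  proper i (inj₂ (uv , _)) (inj₁ (b , _)) _ e = G≢H-colour i i b uv (≡-sym e)

  -- At a vertex v, distinct colourings i ≢ j use f i, f j on G-edges and
  -- g (fibre i u), g (fibre j u) on H-edges, where fibre i u ≢ fibre j u.
  compatible : ∀ i j → i ≢ j → StarCompatible (colouring i) (colouring j)
  compatible i j i≢j (inj₁ (a , _)) (inj₁ (b , _)) e = f-compatible i j i≢j a b (G-colours i j a b e)
  compatible i j i≢j (inj₂ (vu , h)) (inj₂ (vw , h')) e =
    g-compatible _ _ (i≢j ∘ latin-injˡ) h h' (H-colours i j refl (≡-sym vu) refl (≡-sym vw) e)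
  compatible i j _ (inj₁ (a , _)) (inj₂ (vw , _)) e = G≢H-colour i j a vw e
  compatible i j _ (inj₂ (vu , _)) (inj₁ (b , _)) e = G≢H-colour j i b vu (≡-sym e)

  -- Two H-edges pq, rs in the fibres over adjacent u = π₁ q and w = π₁ r, joined
  -- by the G-edge qr, have distinct colours: in H they are edges at the vertex
  -- π₂ q = π₂ r coloured by g (fibre i u) and g (fibre i w), which are compatible
  -- because c u ≢ c w.
  H-G-H : ∀ i {p q r s} → π₁ p ≡ π₁ q → Adj H (π₂ p) (π₂ q) → Adj G (π₁ q) (π₁ r) → π₂ q ≡ π₂ r →
    π₁ r ≡ π₁ s → Adj H (π₂ r) (π₂ s) → colour i p q ≢ colour i r s
  H-G-H i {p} {q} {r} {s} pq h₁ a qr rs h₂ e =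
    g-compatible (fibre i (π₁ q)) (fibre i (π₁ r)) (c-proper a ∘ latin-injʳ)
      (sym H h₁) (subst (λ x → Adj H x (π₂ s)) (≡-sym qr) h₂) (begin
        col (g (fibre i (π₁ q))) (π₂ q) (π₂ p) ≡⟨ ≡-sym (symm (g _) h₁) ⟩
        col (g (fibre i (π₁ q))) (π₂ p) (π₂ q) ≡⟨ H-colours i i pq refl refl (≡-sym rs) e ⟩
        col (g (fibre i (π₁ r))) (π₂ r) (π₂ s) ≡⟨ cong (λ x → col (g (fibre i (π₁ r))) x (π₂ s)) (≡-sym qr) ⟩
        col (g (fibre i (π₁ r))) (π₂ q) (π₂ s) ∎)
    where open ≡-Reasoning

  G-fibre-walk : ∀ i {v0 v1 v2 v3 v4} →
    Adj G (π₁ v0) (π₁ v1) → Adj G (π₁ v1) (π₁ v2) → Adj G (π₁ v2) (π₁ v3) → Adj G (π₁ v3) (π₁ v4) →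
    π₂ v0 ≡ π₂ v1 → π₂ v1 ≡ π₂ v2 → π₂ v2 ≡ π₂ v3 → π₂ v3 ≡ π₂ v4 → PathOrCycle4 P v0 v1 v2 v3 v4 →
    ¬ Alternating (colour i v0 v1) (colour i v1 v2) (colour i v2 v3) (colour i v3 v4)
  G-fibre-walk i {v0} {v1} {v2} {v3} {v4} a₁ a₂ a₃ a₄ y₁ y₂ y₃ y₄ poc (e₁₃ , e₂₄) =
    star-elim {f = f i} (f-star i) (a₁ , a₂ , a₃ , a₄)
      (pathOrCycle-project {P} {G} π₁ π₂ (π-injective G H) refl (≡-sym y₁) s₂ s₃ (trans (≡-sym y₄) s₃) poc)
      (G-colours i i a₁ a₃ e₁₃ , G-colours i i a₂ a₄ e₂₄)
    where
      s₂ : π₂ v2 ≡ π₂ v0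
      s₂ = trans (≡-sym y₂) (≡-sym y₁)
      s₃ : π₂ v3 ≡ π₂ v0
      s₃ = trans (≡-sym y₃) s₂

  H-fibre-walk : ∀ i {v0 v1 v2 v3 v4} →
    π₁ v0 ≡ π₁ v1 → π₁ v1 ≡ π₁ v2 → π₁ v2 ≡ π₁ v3 → π₁ v3 ≡ π₁ v4 →
    Adj H (π₂ v0) (π₂ v1) → Adj H (π₂ v1) (π₂ v2) → Adj H (π₂ v2) (π₂ v3) → Adj H (π₂ v3) (π₂ v4) →
    PathOrCycle4 P v0 v1 v2 v3 v4 →
    ¬ Alternating (colour i v0 v1) (colour i v1 v2) (colour i v2 v3) (colour i v3 v4)
  H-fibre-walk i {v0} {v1} {v2} {v3} {v4} x₁ x₂ x₃ x₄ h₁ h₂ h₃ h₄ poc (e₁₃ , e₂₄) =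
    star-elim {f = g (fibre i (π₁ v0))} (g-star _) (h₁ , h₂ , h₃ , h₄)
      (pathOrCycle-project {P} {H} π₂ π₁ (flip (π-injective G H)) refl s₁ s₂ s₃ s₄ poc)
      (H-colours i i refl s₁ s₂ s₃ e₁₃ , H-colours i i s₁ s₂ s₃ s₄ e₂₄)
    where
      s₁ : π₁ v1 ≡ π₁ v0
      s₁ = ≡-sym x₁
      s₂ : π₁ v2 ≡ π₁ v0
      s₂ = trans (≡-sym x₂) s₁
      s₃ : π₁ v3 ≡ π₁ v0
      s₃ = trans (≡-sym x₃) s₂
      s₄ : π₁ v4 ≡ π₁ v0
      s₄ = trans (≡-sym x₄) s₃

  -- In an alternating walk, edges 1 and 3 (and edges 2 and 4) have the same
  -- kind, since G- and H-edges never share a colour.  This leaves the walks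
  -- inside a fibre and the walks G,H,G,H or H,G,H,G, excluded by H-G-H.
  no-alternating-walk : ∀ i v0 v1 v2 v3 v4 → Walk4Edges P v0 v1 v2 v3 v4 → PathOrCycle4 P v0 v1 v2 v3 v4 →
    ¬ Alternating (colour i v0 v1) (colour i v1 v2) (colour i v2 v3) (colour i v3 v4)
  no-alternating-walk i _ _ _ _ _ (inj₁ (a₁ , _) , _ , inj₂ (x₃ , _) , _) _ (e₁₃ , _) =
    G≢H-colour i i a₁ x₃ e₁₃
  no-alternating-walk i _ _ _ _ _ (inj₂ (x₁ , _) , _ , inj₁ (a₃ , _) , _) _ (e₁₃ , _) =
    G≢H-colour i i a₃ x₁ (≡-sym e₁₃)
  no-alternating-walk i _ _ _ _ _ (_ , inj₁ (a₂ , _) , _ , inj₂ (x₄ , _)) _ (_ , e₂₄) =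
    G≢H-colour i i a₂ x₄ e₂₄
  no-alternating-walk i _ _ _ _ _ (_ , inj₂ (x₂ , _) , _ , inj₁ (a₄ , _)) _ (_ , e₂₄) =
    G≢H-colour i i a₄ x₂ (≡-sym e₂₄)
  no-alternating-walk i _ _ _ _ _ (inj₁ _ , inj₂ (x₂ , h₂) , inj₁ (a₃ , y₃) , inj₂ (x₄ , h₄)) _ (_ , e₂₄) =
    H-G-H i x₂ h₂ a₃ y₃ x₄ h₄ e₂₄
  no-alternating-walk i _ _ _ _ _ (inj₂ (x₁ , h₁) , inj₁ (a₂ , y₂) , inj₂ (x₃ , h₃) , inj₁ _) _ (e₁₃ , _) =
    H-G-H i x₁ h₁ a₂ y₂ x₃ h₃ e₁₃
  no-alternating-walk i _ _ _ _ _
    (inj₁ (a₁ , y₁) , inj₁ (a₂ , y₂) , inj₁ (a₃ , y₃) , inj₁ (a₄ , y₄)) =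
    G-fibre-walk i a₁ a₂ a₃ a₄ y₁ y₂ y₃ y₄
  no-alternating-walk i _ _ _ _ _
    (inj₂ (x₁ , h₁) , inj₂ (x₂ , h₂) , inj₂ (x₃ , h₃) , inj₂ (x₄ , h₄)) =
    H-fibre-walk i x₁ x₂ x₃ x₄ h₁ h₂ h₃ h₄

  star : ∀ i → StarEdgeColoring (colouring i)
  star i = star-intro {f = colouring i} (proper i) (no-alternating-walk i)

product-starColorable : ∀ {G H kG kH t} → StarColorable G kG t → StarColorable H kH t →
  Colorable G t → StarColorable (G □ H) (kG + kH) t
product-starColorable SG SH vc = colouring , star , compatible
  where open ProductColouring SG SH vc

corollary1 : (G : Graph) (kG tG : ℕ) → StarColorable G kG tG →
    (∃[ χ ] (IsChromaticNumber G χ × χ ≤ tG)) →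
    (d : ℕ) .{{_ : NonZero d}} → StarColorable (power G d) (d * kG) tG
corollary1 G kG tG SG (χ , (χ-colouring , _) , χ≤tG) (suc d) = powers d
  where
    vc : Colorable G tG
    vc = colorable-≤ {G} χ≤tG χ-colouring

    -- G_1 = G, and G_{d+2} = G □ G_{d+1} uses kG + (d+1)·kG = (d+2)·kG colours.
    powers : ∀ d → StarColorable (power G (suc d)) (suc d * kG) tG
    powers zero    = subst (λ k → StarColorable G k tG) (≡-sym (+-identityʳ kG)) SG
    powers (suc d) = product-starColorable SG (powers d) vc
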